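{- For packed words $u$ of length $k\ge1$ and $v$ of length $l\ge1$, $$\mathbf{M}_u\#\mathbf{M}_v=\sum_{w\in[u\wedge v,\ u\vee v]}\mathbf{M}_w,$$ where the interval is taken among packed words of length $k+l-1$ for the pseudo-permutohedron order.
   Context: Let $A=\{a_1<a_2<\cdots\}$ be an infinite totally ordered alphabet (identified with $\{1<2<\cdots\}$) and $\mathbb{K}$ a field; work with formal $\mathbb{K}$-linear combinations of nonempty words over $A$. The $\#$ product of words is $(ux)\#(yv)=uxv$ if the letters $x,y$ are equal and $0$ otherwise ($u,v$ words, $x,y$ letters), extended bilinearly. For a word $w$ whose distinct letters are $b_1<\dots<b_r$, $\mathrm{pack}(w)$ is the image of $w$ under $b_i\mapsto i$; $w$ is packed if $\mathrm{pack}(w)=w$. For a packed word $u$, $\mathbf{M}_u=\sum_{\mathrm{pack}(w)=u}w$. For a packed word $w$ of length $n$ and $1\le i<j\le n$, the pair $(i,j)$ has coefficient $1$ if $w_i>w_j$, $1/2$ if $w_i=w_j$, and $0$ if $w_i<w_j$. For packed words $u,v$ of the same length, $u\le v$ in the pseudo-permutohedron order iff the coefficient of every pair $(i,j)$ in $u$ is at most its coefficient in $v$. For packed words $\alpha$ of length $k$ and $\beta$ of length $l$, $\alpha\vee\beta$ is the word obtained by writing, for $i=1,\dots,k$, $\alpha_i+\beta_1-1$ if $\alpha_i\le\alpha_k$ and $\alpha_i+\max(\beta)-1$ if $\alpha_i>\alpha_k$; then for $i=2,\dots,l$, $\beta_i$ if $\beta_i<\beta_1$ and $\beta_i+\alpha_k-1$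 if $\beta_i\ge\beta_1$. The word $\alpha\wedge\beta$ is obtained by writing, for $i=1,\dots,k$, $\alpha_i$ if $\alpha_i<\alpha_k$ and $\alpha_i+\beta_1-1$ if $\alpha_i\ge\alpha_k$; then for $i=2,\dots,l$, $\beta_i+\alpha_k-1$ if $\beta_i\le\beta_1$ and $\beta_i+\max(\alpha)-1$ if $\beta_i>\beta_1$. -}

module Defs where

open import Level using (Level)
open import Data.Bool using (Bool; true; false; if_then_else_)
open import Data.Nat using (ℕ; zero; suc; _+_; _*_; _∸_; _≤_; _<_; _≤ᵇ_; _<ᵇ_; _⊔_; _≟_; _<?_; _≤?_)
open import Data.List using (List; []; _∷_; map; filter; deduplicate; length; take; drop; lookup; _++_; foldr; concatMap; upTo; applyUpTo)
open import Data.List.Properties using (≡-dec)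
open import Data.List.Relation.Unary.All using (All; all?)
open import Data.Product using (_×_; _,_; proj₁; proj₂)
open import Data.Product.Properties using ()
open import Relation.Nullary using (Dec; yes; no)
open import Relation.Nullary.Decidable using (_×-dec_; ⌊_⌋)
open import Relation.Binary.PropositionalEquality using (_≡_)
open import Algebra.Bundles using (CommutativeRing)

-- Words: lists of letters, letters are natural numbers (alphabet A = {1 < 2 < ...}
-- is recovered by restricting to words with all letters ≥ 1 in the theorem).
Word : Set
Word = List ℕ

pack : Word → Word
pack w = map (λ x → suc (length (filter (_<? x) (deduplicate _≟_ w)))) w

IsPacked : Word → Set
IsPacked u = pack u ≡ u

-- i-th letter (0-indexed), default 0
at : Word → ℕ → ℕ
at []       _       = 0
at (x ∷ _)  zero    = x
at (_ ∷ xs) (suc i) = at xs i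

headD : Word → ℕ
headD []      = 0
headD (x ∷ _) = x

lastD : Word → ℕ
lastD []           = 0
lastD (x ∷ [])     = x
lastD (_ ∷ y ∷ ys) = lastD (y ∷ ys)

maxW : Word → ℕ
maxW = foldr _⊔_ 0

-- twice the coefficient of the pair (i,j) (0-indexed positions):
-- 2 if w_i > w_j, 1 if w_i = w_j, 0 if w_i < w_j
coef2 : Word → ℕ → ℕ → ℕ
coef2 w i j = if at w j <ᵇ at w i then 2 else (if at w i <ᵇ at w j then 0 else 1)

pairs : ℕ → List (ℕ × ℕ)
pairs n = concatMap (λ j → map (λ i → (i , j)) (upTo j)) (upTo n)

_≤pp_ : Word → Word → Set
u ≤pp v = (length u ≡ length v) × All (λ p → coef2 u (proj₁ p) (proj₂ p) ≤ coef2 v (proj₁ p) (proj₂ p)) (pairs (length u))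

_≤pp?_ : (u v : Word) → Dec (u ≤pp v)
u ≤pp? v = (length u ≟ length v) ×-dec all? (λ p → coef2 u (proj₁ p) (proj₂ p) ≤? coef2 v (proj₁ p) (proj₂ p)) (pairs (length u))

_∨w_ : Word → Word → Word
α ∨w β = map f α ++ map g (drop 1 β)
  where
  ak = lastD α
  b1 = headD β
  f : ℕ → ℕ
  f a = if a ≤ᵇ ak then a + b1 ∸ 1 else a + maxW β ∸ 1
  g : ℕ → ℕ
  g b = if b <ᵇ b1 then b else b + ak ∸ 1

_∧w_ : Word → Word → Word
α ∧w β = map f α ++ map g (drop 1 β)
  where
  ak = lastD α
  b1 = headD β
  f : ℕ → ℕ
  f a = if a <ᵇ ak then a else a + b1 ∸ 1
  g : ℕ → ℕ
  g b = if b ≤ᵇ b1 then b + ak ∸ 1 else b + maxW α ∸ 1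

wordsOver : ℕ → ℕ → List Word
wordsOver m zero    = [] ∷ []
wordsOver m (suc n) = concatMap (λ a → map (a ∷_) (wordsOver m n)) (applyUpTo suc m)

packedWords : ℕ → List Word
packedWords n = filter (λ w → ≡-dec _≟_ (pack w) w) (wordsOver n n)

interval : ℕ → Word → Word → List Word
interval n a b = filter (λ w → (a ≤pp? w) ×-dec (w ≤pp? b)) (packedWords n)

module Series {c ℓ : Level} (R : CommutativeRing c ℓ) where
  open CommutativeRing R using (Carrier; 0#; 1#) renaming (_+_ to _+R_; _*_ to _*R_)

  -- formal series: coefficient function on words
  Ser : Set c
  Ser = Word → Carrier

  Σ : List Carrier → Carrier
  Σ = foldr _+R_ 0#

  -- M_u = Σ_{pack w = u} w
  M : Word → Ser
  M u w = if ⌊ ≡-dec _≟_ (pack w) u ⌋ then 1# else 0#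

  -- bilinear extension of (ux)#(yv) = uxv if x = y, 0 otherwise:
  -- the words x, y with x # y = w (nonzero) are x = w[1..i], y = w[i..n], 1 ≤ i ≤ n
  _#_ : Ser → Ser → Ser
  (f # g) w = Σ (map (λ i → f (take (suc i) w) *R g (drop i w)) (upTo (length w)))

  ΣM : List Word → Ser
  ΣM ws w = Σ (map (λ x → M x w) ws)

-- In (M u # M v)(w) the term for the splitting at position i is M u (w[..i]) · M v (w[i..]); as pack
-- preserves length, only i = |u| can contribute, so the left side is 1 exactly when
-- pack (w[..|u|]) = u and pack (w[|u|..]) = v, and 0 otherwise. The right side is 1 exactly when
-- pack w lies in the interval, the words of the sum being distinct. Since pack w has the same order
-- pattern as w and is determined by it, both conditions say that the order pattern of w is that of u on
-- the first |u| positions and that of v on the last |v| (the two blocks share one position). The letter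
-- maps defining u ∧ v and u ∨ v are strictly increasing on each block, so inside a block the
-- coefficients of u ∧ v, pack w and u ∨ v coincide. For a pair i < k < j straddling the shared position
-- k, the coefficient of (i, j) in w is the maximum of those of (i, k) and (k, j) when both are ≥ 1, and
-- their minimum when both are ≤ 1; u ∧ v realises it in the first case and has coefficient 0 otherwise,
-- u ∨ v realises it in the second case and has coefficient 2 otherwise.
module Submission where

open import Defs
open import Level using (Level; 0ℓ)
open import Data.Bool using (Bool; true; false; if_then_else_)
open import Data.Bool.Properties using (T-≡)
open import Data.Nat
open import Data.Nat.Properties
open import Data.List
  using (List; []; _∷_; length; map; filter; deduplicate; take; drop; _++_; concatMap; applyUpTo; cartesianProductWith)
open import Data.List.Properties
  using ( ≡-dec; map-upTo; ∷-injective; length-map; length-++; length-take; length-drop; length-deduplicate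
        ; filter-accept; filter-reject; filter-≐; filter-notAll)
open import Data.List.Membership.Propositional using (_∈_; _∉_)
open import Data.List.Membership.DecPropositional (≡-dec _≟_) using (_∈?_)
open import Data.List.Membership.Propositional.Properties
  using (∈-filter⁺; ∈-filter⁻; ∈-deduplicate⁺; ∈-applyUpTo⁺; ∈-cartesianProductWith⁺; ∈-cartesianProductWith⁻)
open import Data.List.Relation.Unary.Unique.Propositional using (Unique)
open import Data.List.Relation.Unary.AllPairs using ([]; _∷_)
import Data.List.Relation.Unary.Unique.Propositional.Properties as Unique
open import Data.List.Relation.Unary.Any as Any using (here; there)
open import Data.List.Relation.Unary.All using (All; []; _∷_; lookup)
import Data.List.Relation.Unary.All.Properties as All
open import Data.Product using (_×_; _,_; proj₁; proj₂)
open import Data.Product.Function.NonDependent.Propositional using (_×-⇔_)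
open import Data.Sum using (_⊎_; inj₁; inj₂; map₁)
open import Function using (_∘_; id; _⇔_; mk⇔; Equivalence)
import Function.Properties.Equivalence as ⇔
open import Relation.Nullary using (¬_; Dec; yes; no; contradiction; ¬?)
open import Relation.Nullary.Decidable using (⌊_⌋; _⊎-dec_; _×-dec_)
open import Relation.Unary using (Pred; Decidable; _∩_; _⊆_)
open import Relation.Unary.Properties using (_∩?_)
open import Relation.Binary.PropositionalEquality
  using (_≡_; _≢_; refl; sym; trans; cong; cong₂; subst; subst₂; module ≡-Reasoning)
open import Relation.Binary.Core using (_Preserves_⟶_)
open import Relation.Binary.Definitions using (tri<; tri≈; tri>)
open import Algebra.Bundles using (CommutativeRing)

<ᵇ-true : ∀ {m n} → m < n → (m <ᵇ n) ≡ true
<ᵇ-true m<n = Equivalence.to T-≡ (<⇒<ᵇ m<n)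

≤ᵇ-true : ∀ {m n} → m ≤ n → (m ≤ᵇ n) ≡ true
≤ᵇ-true m≤n = Equivalence.to T-≡ (≤⇒≤ᵇ m≤n)

≤ᵇ-false : ∀ {m n} → ¬ m ≤ n → (m ≤ᵇ n) ≡ false
≤ᵇ-false {m} {n} m≰n with m ≤ᵇ n in eq
... | true  = contradiction (≤ᵇ⇒≤ m n (Equivalence.from T-≡ eq)) m≰n
... | false = refl

<ᵇ-false : ∀ {m n} → ¬ m < n → (m <ᵇ n) ≡ false
<ᵇ-false {m} {n} m≮n with m <ᵇ n in eq
... | true  = contradiction (<ᵇ⇒< m n (Equivalence.from T-≡ eq)) m≮n
... | false = refl

-- It is opaque so that Agda compares its arguments instead of unfolding the conditionals, which
-- lets implicit arguments be inferred from equations between coefficients.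
opaque
  pairCoef : ℕ → ℕ → ℕ
  pairCoef x y = if y <ᵇ x then 2 else (if x <ᵇ y then 0 else 1)

  coef2≡pairCoef : ∀ w i j → coef2 w i j ≡ pairCoef (at w i) (at w j)
  coef2≡pairCoef w i j = refl

  pairCoef-< : ∀ {x y} → x < y → pairCoef x y ≡ 0
  pairCoef-< x<y rewrite <ᵇ-false (<⇒≯ x<y) | <ᵇ-true x<y = refl

  pairCoef-> : ∀ {x y} → y < x → pairCoef x y ≡ 2
  pairCoef-> y<x rewrite <ᵇ-true y<x = refl

  pairCoef-refl : ∀ x → pairCoef x x ≡ 1
  pairCoef-refl x rewrite <ᵇ-false (n≮n x) = refl

pairCoef≤2 : ∀ x y → pairCoef x y ≤ 2
pairCoef≤2 x y with <-cmp x y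
... | tri< x<y _ _ rewrite pairCoef-< x<y = z≤n
... | tri≈ _ refl _ rewrite pairCoef-refl x = s≤s z≤n
... | tri> _ _ y<x rewrite pairCoef-> y<x = ≤-refl

pairCoef-swap : ∀ x y → pairCoef y x ≡ 2 ∸ pairCoef x y
pairCoef-swap x y with <-cmp x y
... | tri< x<y _ _ rewrite pairCoef-< x<y | pairCoef-> x<y = refl
... | tri≈ _ refl _ rewrite pairCoef-refl x = refl
... | tri> _ _ y<x rewrite pairCoef-> y<x | pairCoef-< y<x = refl

pairCoef-preserved : ∀ {x y x′ y′} → (x < y → x′ < y′) → (y < x → y′ < x′) → (x ≡ y → x′ ≡ y′) →
                     pairCoef x′ y′ ≡ pairCoef x y
pairCoef-preserved {x} {y} {x′} {y′} lt gt eq with <-cmp x y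
... | tri< x<y _ _ rewrite pairCoef-< x<y = pairCoef-< (lt x<y)
... | tri≈ _ refl _ rewrite eq refl | pairCoef-refl x = pairCoef-refl y′
... | tri> _ _ y<x rewrite pairCoef-> y<x = pairCoef-> (gt y<x)

strictMono⇒pairCoef≡ : ∀ {f} → f Preserves _<_ ⟶ _<_ → ∀ x y → pairCoef (f x) (f y) ≡ pairCoef x y
strictMono⇒pairCoef≡ {f} mono x y = pairCoef-preserved mono mono (cong f)

pairCoef≡0⇒< : ∀ {x y} → pairCoef x y ≡ 0 → x < y
pairCoef≡0⇒< {x} {y} c with <-cmp x y
... | tri< x<y _ _ = x<y
... | tri≈ _ refl _ = contradiction (trans (sym (pairCoef-refl x)) c) λ ()
... | tri> _ _ y<x = contradiction (trans (sym (pairCoef-> y<x)) c) λ ()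

pairCoef≡1⇒≡ : ∀ {x y} → pairCoef x y ≡ 1 → x ≡ y
pairCoef≡1⇒≡ {x} {y} c with <-cmp x y
... | tri< x<y _ _ = contradiction (trans (sym (pairCoef-< x<y)) c) λ ()
... | tri≈ _ x≡y _ = x≡y
... | tri> _ _ y<x = contradiction (trans (sym (pairCoef-> y<x)) c) λ ()

pairCoef≡⇒< : ∀ {x y x′ y′} → pairCoef x y ≡ pairCoef x′ y′ → x < y → x′ < y′
pairCoef≡⇒< c x<y = pairCoef≡0⇒< (trans (sym c) (pairCoef-< x<y))

pairCoef≡⇒≡ : ∀ {x y x′ y′} → pairCoef x y ≡ pairCoef x′ y′ → x ≡ y → x′ ≡ y′
pairCoef≡⇒≡ {x} c refl = pairCoef≡1⇒≡ (trans (sym c) (pairCoef-refl x))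

pairCoef≡2⇒> : ∀ {x y} → pairCoef x y ≡ 2 → y < x
pairCoef≡2⇒> {x} {y} c with <-cmp x y
... | tri< x<y _ _ = contradiction (trans (sym (pairCoef-< x<y)) c) λ ()
... | tri≈ _ refl _ = contradiction (trans (sym (pairCoef-refl x)) c) λ ()
... | tri> _ _ y<x = y<x

pairCoef≡⇒> : ∀ {x y x′ y′} → pairCoef x y ≡ pairCoef x′ y′ → y < x → y′ < x′
pairCoef≡⇒> c y<x = pairCoef≡2⇒> (trans (sym c) (pairCoef-> y<x))

pairCoef≡⇒≥ : ∀ {x y x′ y′} → pairCoef x y ≡ pairCoef x′ y′ → y ≤ x → y′ ≤ x′
pairCoef≡⇒≥ c y≤x = ≮⇒≥ (λ x′<y′ → <⇒≱ (pairCoef≡⇒< (sym c) x′<y′) y≤x)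

pairCoef≡⇒≤ : ∀ {x y x′ y′} → pairCoef x y ≡ pairCoef x′ y′ → x ≤ y → x′ ≤ y′
pairCoef≡⇒≤ c x≤y = ≮⇒≥ (λ y′<x′ → <⇒≱ (pairCoef≡⇒> (sym c) y′<x′) x≤y)

pairCoef-⊔ : ∀ {x y z} → z ≤ y → y ≤ x → pairCoef x z ≡ pairCoef x y ⊔ pairCoef y z
pairCoef-⊔ {x} {y} {z} z≤y y≤x with m≤n⇒m<n∨m≡n z≤y | m≤n⇒m<n∨m≡n y≤x
... | inj₁ z<y  | inj₁ y<x  = trans (pairCoef-> (<-trans z<y y<x)) (sym (cong₂ _⊔_ (pairCoef-> y<x) (pairCoef-> z<y)))
... | inj₁ z<y  | inj₂ refl = trans (pairCoef-> z<y) (sym (cong₂ _⊔_ (pairCoef-refl y) (pairCoef-> z<y)))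
... | inj₂ refl | inj₁ y<x  = trans (pairCoef-> y<x) (sym (cong₂ _⊔_ (pairCoef-> y<x) (pairCoef-refl y)))
... | inj₂ refl | inj₂ refl = trans (pairCoef-refl y) (sym (cong₂ _⊔_ (pairCoef-refl y) (pairCoef-refl y)))

pairCoef-⊓ : ∀ {x y z} → x ≤ y → y ≤ z → pairCoef x z ≡ pairCoef x y ⊓ pairCoef y z
pairCoef-⊓ {x} {y} {z} x≤y y≤z with m≤n⇒m<n∨m≡n x≤y | m≤n⇒m<n∨m≡n y≤z
... | inj₁ x<y  | inj₁ y<z  = trans (pairCoef-< (<-trans x<y y<z)) (sym (cong₂ _⊓_ (pairCoef-< x<y) (pairCoef-< y<z)))
... | inj₁ x<y  | inj₂ refl = trans (pairCoef-< x<y) (sym (cong₂ _⊓_ (pairCoef-< x<y) (pairCoef-refl y)))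
... | inj₂ refl | inj₁ y<z  = trans (pairCoef-< y<z) (sym (cong₂ _⊓_ (pairCoef-refl y) (pairCoef-< y<z)))
... | inj₂ refl | inj₂ refl = trans (pairCoef-refl y) (sym (cong₂ _⊓_ (pairCoef-refl y) (pairCoef-refl y)))

record SameOrder (n : ℕ) (F G : ℕ → ℕ) : Set where
  constructor sameOrder
  field coef≡ : ∀ {i j} → i < n → j < n → pairCoef (F i) (F j) ≡ pairCoef (G i) (G j)

open SameOrder public

record Coef≤ (n : ℕ) (F G : ℕ → ℕ) : Set where
  constructor coefLe
  field coef≤ : ∀ {i j} → i < j → j < n → pairCoef (F i) (F j) ≤ pairCoef (G i) (G j)

open Coef≤ public

module _ {F G : ℕ → ℕ} where

  SameOrder-sym : ∀ {n} → SameOrder n F G → SameOrder n G F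
  SameOrder-sym s = sameOrder λ i<n j<n → sym (coef≡ s i<n j<n)

  SameOrder-trans : ∀ {n H} → SameOrder n F G → SameOrder n G H → SameOrder n F H
  SameOrder-trans s t = sameOrder λ i<n j<n → trans (coef≡ s i<n j<n) (coef≡ t i<n j<n)

  SameOrder-shift : ∀ k {n} → SameOrder (k + n) F G → SameOrder n (F ∘ (k +_)) (G ∘ (k +_))
  SameOrder-shift k s = sameOrder λ i<n j<n → coef≡ s (+-monoʳ-< k i<n) (+-monoʳ-< k j<n)

  SameOrder-congˡ : ∀ {n H} → (∀ {i} → i < n → F i ≡ H i) → SameOrder n F G → SameOrder n H G
  SameOrder-congˡ F≗H s = sameOrder λ i<n j<n →
    trans (sym (cong₂ pairCoef (F≗H i<n) (F≗H j<n))) (coef≡ s i<n j<n)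

  SameOrder⇒Coef≤ : ∀ {n} → SameOrder n F G → Coef≤ n F G
  SameOrder⇒Coef≤ s = coefLe λ i<j j<n → ≤-reflexive (coef≡ s (<-trans i<j j<n) j<n)

  Coef≤-antisym : ∀ {n} → Coef≤ n F G → Coef≤ n G F → SameOrder n F G
  Coef≤-antisym {n} F≤G G≤F = sameOrder same
    where
    same : ∀ {i j} → i < n → j < n → pairCoef (F i) (F j) ≡ pairCoef (G i) (G j)
    same {i} {j} i<n j<n with <-cmp i j
    ... | tri< i<j _ _ = ≤-antisym (coef≤ F≤G i<j j<n) (coef≤ G≤F i<j j<n)
    ... | tri≈ _ refl _ = trans (pairCoef-refl (F i)) (sym (pairCoef-refl (G i)))
    ... | tri> _ _ j<i = begin
      pairCoef (F i) (F j)      ≡⟨ pairCoef-swap (F j) (F i) ⟩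
      2 ∸ pairCoef (F j) (F i)  ≡⟨ cong (2 ∸_) (≤-antisym (coef≤ F≤G j<i i<n) (coef≤ G≤F j<i i<n)) ⟩
      2 ∸ pairCoef (G j) (G i)  ≡⟨ pairCoef-swap (G j) (G i) ⟨
      pairCoef (G i) (G j)      ∎
      where open ≡-Reasoning

  Coef≤-≤ : ∀ {m n} → m ≤ n → Coef≤ n F G → Coef≤ m F G
  Coef≤-≤ m≤n F≤G = coefLe λ i<j j<m → coef≤ F≤G i<j (<-≤-trans j<m m≤n)

  Coef≤-shift : ∀ k {n} → Coef≤ (k + n) F G → Coef≤ n (F ∘ (k +_)) (G ∘ (k +_))
  Coef≤-shift k F≤G = coefLe λ i<j j<n → coef≤ F≤G (+-monoʳ-< k i<j) (+-monoʳ-< k j<n)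

  Coef≤-respˡ : ∀ {n H} → SameOrder n F H → Coef≤ n F G → Coef≤ n H G
  Coef≤-respˡ s F≤G = coefLe λ i<j j<n → subst (_≤ _) (coef≡ s (<-trans i<j j<n) j<n) (coef≤ F≤G i<j j<n)

  Coef≤-respʳ : ∀ {n H} → SameOrder n G H → Coef≤ n F G → Coef≤ n F H
  Coef≤-respʳ s F≤G = coefLe λ i<j j<n → subst (_ ≤_) (coef≡ s (<-trans i<j j<n) j<n) (coef≤ F≤G i<j j<n)

strictMono⇒SameOrder : ∀ {f n} → f Preserves _<_ ⟶ _<_ → ∀ G → SameOrder n (f ∘ G) G
strictMono⇒SameOrder mono G = sameOrder λ {i} {j} _ _ → strictMono⇒pairCoef≡ mono (G i) (G j)

at-map : ∀ (f : ℕ → ℕ) xs {i} → i < length xs → at (map f xs) i ≡ f (at xs i)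
at-map f (x ∷ xs) {zero}  _         = refl
at-map f (x ∷ xs) {suc i} (s≤s i<n) = at-map f xs i<n

at-++ˡ : ∀ xs ys {i} → i < length xs → at (xs ++ ys) i ≡ at xs i
at-++ˡ (x ∷ xs) ys {zero}  _         = refl
at-++ˡ (x ∷ xs) ys {suc i} (s≤s i<n) = at-++ˡ xs ys i<n

at-++ʳ : ∀ xs ys i → at (xs ++ ys) (length xs + i) ≡ at ys i
at-++ʳ []       ys i = refl
at-++ʳ (x ∷ xs) ys i = at-++ʳ xs ys i

at-take : ∀ k w {i} → i < k → at (take k w) i ≡ at w i
at-take (suc k) []      _                 = refl
at-take (suc k) (x ∷ w) {zero}  _         = refl
at-take (suc k) (x ∷ w) {suc i} (s≤s i<k) = at-take k w i<k

at-drop : ∀ k w i → at (drop k w) i ≡ at w (k + i)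
at-drop zero    w       i = refl
at-drop (suc k) []      i = refl
at-drop (suc k) (x ∷ w) i = at-drop k w i

at-∈ : ∀ w {i} → i < length w → at w i ∈ w
at-∈ (x ∷ w) {zero}  _         = here refl
at-∈ (x ∷ w) {suc i} (s≤s i<n) = there (at-∈ w i<n)

lastD≡at : ∀ x xs → lastD (x ∷ xs) ≡ at (x ∷ xs) (length xs)
lastD≡at x []       = refl
lastD≡at x (y ∷ ys) = lastD≡at y ys

at≤maxW : ∀ w i → at w i ≤ maxW w
at≤maxW []      i       = z≤n
at≤maxW (x ∷ w) zero    = m≤m⊔n x (maxW w)
at≤maxW (x ∷ w) (suc i) = ≤-trans (at≤maxW w i) (m≤n⊔m x (maxW w))

at-ext : ∀ xs ys → length xs ≡ length ys → (∀ {i} → i < length xs → at xs i ≡ at ys i) → xs ≡ ys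
at-ext []       []       _   _  = refl
at-ext (x ∷ xs) (y ∷ ys) len eq =
  cong₂ _∷_ (eq (s≤s z≤n)) (at-ext xs ys (suc-injective len) (eq ∘ s≤s))

module _ {P Q : Pred ℕ 0ℓ} (P? : Decidable P) (Q? : Decidable Q) where

  filter-filter : ∀ xs → filter P? (filter Q? xs) ≡ filter (P? ∩? Q?) xs
  filter-filter [] = refl
  filter-filter (x ∷ xs) = by-cases (P? x) (Q? x)
    where
    open ≡-Reasoning
    by-cases : Dec (P x) → Dec (Q x) → filter P? (filter Q? (x ∷ xs)) ≡ filter (P? ∩? Q?) (x ∷ xs)
    by-cases (yes p) (yes q) = begin
      filter P? (filter Q? (x ∷ xs))  ≡⟨ cong (filter P?) (filter-accept Q? q) ⟩
      filter P? (x ∷ filter Q? xs)    ≡⟨ filter-accept P? p ⟩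
      x ∷ filter P? (filter Q? xs)    ≡⟨ cong (x ∷_) (filter-filter xs) ⟩
      x ∷ filter (P? ∩? Q?) xs        ≡⟨ filter-accept (P? ∩? Q?) (p , q) ⟨
      filter (P? ∩? Q?) (x ∷ xs)      ∎
    by-cases (no ¬p) (yes q) = begin
      filter P? (filter Q? (x ∷ xs))  ≡⟨ cong (filter P?) (filter-accept Q? q) ⟩
      filter P? (x ∷ filter Q? xs)    ≡⟨ filter-reject P? ¬p ⟩
      filter P? (filter Q? xs)        ≡⟨ filter-filter xs ⟩
      filter (P? ∩? Q?) xs            ≡⟨ filter-reject (P? ∩? Q?) (¬p ∘ proj₁) ⟨
      filter (P? ∩? Q?) (x ∷ xs)      ∎
    by-cases _ (no ¬q) = begin
      filter P? (filter Q? (x ∷ xs))  ≡⟨ cong (filter P?) (filter-reject Q? ¬q) ⟩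
      filter P? (filter Q? xs)        ≡⟨ filter-filter xs ⟩
      filter (P? ∩? Q?) xs            ≡⟨ filter-reject (P? ∩? Q?) (¬q ∘ proj₂) ⟨
      filter (P? ∩? Q?) (x ∷ xs)      ∎

  length-filter-< : P ⊆ Q → ∀ {z} xs → z ∈ xs → Q z → ¬ P z →
                           length (filter P? xs) < length (filter Q? xs)
  length-filter-< P⊆Q {z} xs z∈xs qz ¬pz = begin-strict
    length (filter P? xs)               ≡⟨ cong length (filter-≐ P? (P? ∩? Q?) ((λ p → p , P⊆Q p) , proj₁) xs) ⟩
    length (filter (P? ∩? Q?) xs)       ≡⟨ cong length (filter-filter xs) ⟨
    length (filter P? (filter Q? xs))   <⟨ filter-notAll P? (filter Q? xs) (Any.map (λ { refl → ¬pz }) z∈filter) ⟩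
    length (filter Q? xs)               ∎
    where
    open ≤-Reasoning
    z∈filter = ∈-filter⁺ Q? z∈xs qz

rank : Word → ℕ → ℕ
rank w s = length (filter (_<? s) (deduplicate _≟_ w))

at-pack : ∀ w {i} → i < length w → at (pack w) i ≡ suc (rank w (at w i))
at-pack w = at-map _ w

length-pack : ∀ w → length (pack w) ≡ length w
length-pack w = length-map _ w

pack≡⇒length≡ : ∀ {xs ys} → pack xs ≡ ys → length xs ≡ length ys
pack≡⇒length≡ {xs} refl = sym (length-pack xs)

rank-<-mono : ∀ w {s t} → s ∈ w → s < t → rank w s < rank w t
rank-<-mono w s∈w s<t =
  length-filter-< (_<? _) (_<? _) (λ z<s → <-trans z<s s<t) (deduplicate _≟_ w) (∈-deduplicate⁺ _≟_ s∈w) s<t (n≮n _)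

rank<length : ∀ w {s} → s ∈ w → rank w s < length w
rank<length w s∈w = <-≤-trans
  (filter-notAll (_<? _) (deduplicate _≟_ w) (Any.map (λ { refl → n≮n _ }) (∈-deduplicate⁺ _≟_ s∈w)))
  (length-deduplicate _≟_ w)

pack-SameOrder : ∀ w → SameOrder (length w) (at (pack w)) (at w)
pack-SameOrder w = sameOrder coef
  where
  coef : ∀ {i j} → i < length w → j < length w → pairCoef (at (pack w) i) (at (pack w) j) ≡ pairCoef (at w i) (at w j)
  coef {i} {j} i<n j<n rewrite at-pack w i<n | at-pack w j<n =
    pairCoef-preserved (s≤s ∘ rank-<-mono w (at-∈ w i<n)) (s≤s ∘ rank-<-mono w (at-∈ w j<n)) (cong (suc ∘ rank w))

length-filter-deduplicate-cong : ∀ {P Q : Pred ℕ 0ℓ} (P? : Decidable P) (Q? : Decidable Q) xs ys →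
  length xs ≡ length ys → SameOrder (length xs) (at xs) (at ys) →
  (∀ {j} → j < length xs → P (at xs j) ⇔ Q (at ys j)) →
  length (filter P? (deduplicate _≟_ xs)) ≡ length (filter Q? (deduplicate _≟_ ys))
length-filter-deduplicate-cong P? Q? [] [] _ _ _ = refl
length-filter-deduplicate-cong {P} {Q} P? Q? (a ∷ as) (b ∷ bs) len same P⇔Q = by-cases (P? a) (Q? b)
  where
  open ≡-Reasoning
  rest-as = filter (¬? ∘ (a ≟_)) (deduplicate _≟_ as)
  rest-bs = filter (¬? ∘ (b ≟_)) (deduplicate _≟_ bs)

  tail⇔ : ∀ {j} → j < length as → (P ∩ (λ x → ¬ a ≡ x)) (at as j) ⇔ (Q ∩ (λ y → ¬ b ≡ y)) (at bs j)
  tail⇔ j<n = mk⇔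
    (λ (p , a≢) → Equivalence.to (P⇔Q (s≤s j<n)) p , a≢ ∘ pairCoef≡⇒≡ (sym (coef≡ same z<s (s≤s j<n))))
    (λ (q , b≢) → Equivalence.from (P⇔Q (s≤s j<n)) q , b≢ ∘ pairCoef≡⇒≡ (coef≡ same z<s (s≤s j<n)))

  rest : length (filter P? rest-as) ≡ length (filter Q? rest-bs)
  rest = begin
    length (filter P? rest-as)  ≡⟨ cong length (filter-filter P? (¬? ∘ (a ≟_)) (deduplicate _≟_ as)) ⟩
    length (filter (P? ∩? (¬? ∘ (a ≟_))) (deduplicate _≟_ as))
      ≡⟨ length-filter-deduplicate-cong _ _ as bs (suc-injective len) (SameOrder-shift 1 same) tail⇔ ⟩
    length (filter (Q? ∩? (¬? ∘ (b ≟_))) (deduplicate _≟_ bs))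
      ≡⟨ cong length (filter-filter Q? (¬? ∘ (b ≟_)) (deduplicate _≟_ bs)) ⟨
    length (filter Q? rest-bs)  ∎

  by-cases : Dec (P a) → Dec (Q b) → length (filter P? (a ∷ rest-as)) ≡ length (filter Q? (b ∷ rest-bs))
  by-cases (yes p) (yes q) = begin
    length (filter P? (a ∷ rest-as))  ≡⟨ cong length (filter-accept P? p) ⟩
    suc (length (filter P? rest-as))  ≡⟨ cong suc rest ⟩
    suc (length (filter Q? rest-bs))  ≡⟨ cong length (filter-accept Q? q) ⟨
    length (filter Q? (b ∷ rest-bs))  ∎
  by-cases (no ¬p) (no ¬q) = begin
    length (filter P? (a ∷ rest-as))  ≡⟨ cong length (filter-reject P? ¬p) ⟩
    length (filter P? rest-as)        ≡⟨ rest ⟩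
    length (filter Q? rest-bs)        ≡⟨ cong length (filter-reject Q? ¬q) ⟨
    length (filter Q? (b ∷ rest-bs))  ∎
  by-cases (yes p) (no ¬q) = contradiction (Equivalence.to (P⇔Q z<s) p) ¬q
  by-cases (no ¬p) (yes q) = contradiction (Equivalence.from (P⇔Q z<s) q) ¬p

SameOrder⇒pack≡ : ∀ xs ys → length xs ≡ length ys → SameOrder (length xs) (at xs) (at ys) → pack xs ≡ pack ys
SameOrder⇒pack≡ xs ys len same = at-ext (pack xs) (pack ys)
  (trans (length-pack xs) (trans len (sym (length-pack ys))))
  (λ i<n → letter (subst (_ <_) (length-pack xs) i<n))
  where
  letter : ∀ {i} → i < length xs → at (pack xs) i ≡ at (pack ys) i
  letter {i} i<n rewrite at-pack xs i<n | at-pack ys (subst (i <_) len i<n) =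
    cong suc (length-filter-deduplicate-cong (_<? at xs i) (_<? at ys i) xs ys len same
      (λ j<n → mk⇔ (pairCoef≡⇒< (coef≡ same j<n i<n)) (pairCoef≡⇒< (sym (coef≡ same j<n i<n)))))

pack-idem : ∀ w → pack (pack w) ≡ pack w
pack-idem w = SameOrder⇒pack≡ (pack w) w (length-pack w)
  (subst (λ n → SameOrder n (at (pack w)) (at w)) (sym (length-pack w)) (pack-SameOrder w))

pack≡⇔SameOrder : ∀ xs u → IsPacked u → pack xs ≡ u ⇔ (length xs ≡ length u × SameOrder (length u) (at xs) (at u))
pack≡⇔SameOrder xs u packed = mk⇔ to from
  where
  to : pack xs ≡ u → length xs ≡ length u × SameOrder (length u) (at xs) (at u)
  to refl = sym (length-pack xs)
          , subst (λ n → SameOrder n (at xs) (at (pack xs))) (sym (length-pack xs)) (SameOrder-sym (pack-SameOrder xs))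
  from : length xs ≡ length u × SameOrder (length u) (at xs) (at u) → pack xs ≡ u
  from (len , same) = trans (SameOrder⇒pack≡ xs u len (subst (λ n → SameOrder n (at xs) (at u)) (sym len) same)) packed

pack-letter-bounds : ∀ w {i} → i < length w → 1 ≤ at (pack w) i × at (pack w) i ≤ length w
pack-letter-bounds w i<n rewrite at-pack w i<n = s≤s z≤n , rank<length w (at-∈ w i<n)

All-pairs⁻ : ∀ {P : ℕ × ℕ → Set} n → All P (pairs n) → ∀ {i j} → i < j → j < n → P (i , j)
All-pairs⁻ n all i<j j<n = All.applyUpTo⁻ id _ (All.map⁻ (All.applyUpTo⁻ id n (All.map⁻ (All.concat⁻ all)) j<n)) i<j

All-pairs⁺ : ∀ {P : ℕ × ℕ → Set} n → (∀ {i j} → i < j → j < n → P (i , j)) → All P (pairs n)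
All-pairs⁺ n p =
  All.concat⁺ (All.map⁺ (All.applyUpTo⁺₁ id n λ j<n → All.map⁺ (All.applyUpTo⁺₁ id _ λ i<j → p i<j j<n)))

≤pp⇔Coef≤ : ∀ u v → u ≤pp v ⇔ (length u ≡ length v × Coef≤ (length u) (at u) (at v))
≤pp⇔Coef≤ u v = mk⇔
  (λ (len , all) → len , coefLe λ {i} {j} i<j j<n →
    subst₂ _≤_ (coef2≡pairCoef u i j) (coef2≡pairCoef v i j) (All-pairs⁻ (length u) all i<j j<n))
  (λ (len , le) → len , All-pairs⁺ (length u) λ {i} {j} i<j j<n →
    subst₂ _≤_ (sym (coef2≡pairCoef u i j)) (sym (coef2≡pairCoef v i j)) (coef≤ le i<j j<n))

≤pp-pack⇔ : ∀ {n} x w → length x ≡ n → length w ≡ n → x ≤pp pack w ⇔ Coef≤ n (at x) (at w)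
≤pp-pack⇔ x w refl len = mk⇔
  (λ x≤ → Coef≤-respʳ packed-order (proj₂ (Equivalence.to (≤pp⇔Coef≤ x (pack w)) x≤)))
  (λ c → Equivalence.from (≤pp⇔Coef≤ x (pack w))
           (trans (sym len) (sym (length-pack w)) , Coef≤-respʳ (SameOrder-sym packed-order) c))
  where
  packed-order : SameOrder (length x) (at (pack w)) (at w)
  packed-order = subst (λ n → SameOrder n (at (pack w)) (at w)) len (pack-SameOrder w)

pack-≤pp⇔ : ∀ {n} x w → length x ≡ n → length w ≡ n → pack w ≤pp x ⇔ Coef≤ n (at w) (at x)
pack-≤pp⇔ x w len refl = mk⇔
  (λ ≤x → subst (λ m → Coef≤ m (at w) (at x)) (length-pack w)
            (Coef≤-respˡ packed-order (proj₂ (Equivalence.to (≤pp⇔Coef≤ (pack w) x) ≤x))))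
  (λ c → Equivalence.from (≤pp⇔Coef≤ (pack w) x)
           ( trans (length-pack w) (sym len)
           , Coef≤-respˡ (SameOrder-sym packed-order) (subst (λ m → Coef≤ m (at w) (at x)) (sym (length-pack w)) c)))
  where
  packed-order : SameOrder (length (pack w)) (at (pack w)) (at w)
  packed-order = subst (λ n → SameOrder n (at (pack w)) (at w)) (sym (length-pack w)) (pack-SameOrder w)

split-pairs : ∀ {P : ℕ → ℕ → Set} k l →
  (∀ {i j} → i < j → j < suc k → P i j) →
  (∀ {i j} → i < j → j < suc l → P (k + i) (k + j)) →
  (∀ {i j} → i < k → 0 < j → j < suc l → P i (k + j)) →
  ∀ {i j} → i < j → j < k + suc l → P i j
split-pairs {P} k l pre suf cross {i} {j} i<j j<N with j <? suc k | k ≤? i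
... | yes j≤k | _       = pre i<j j≤k
... | no  j≰k | yes k≤i =
  subst₂ P (m+[n∸m]≡n k≤i) (m+[n∸m]≡n k≤j) (suf (∸-monoˡ-< i<j k≤i) (m<n+o⇒m∸n<o j k j<N))
  where k≤j = <⇒≤ (≮⇒≥ j≰k)
... | no  j≰k | no  k≰i =
  subst (P i) (m+[n∸m]≡n k≤j) (cross (≰⇒> k≰i) (m<n⇒0<n∸m (≮⇒≥ j≰k)) (m<n+o⇒m∸n<o j k j<N))
  where k≤j = <⇒≤ (≮⇒≥ j≰k)

-- Positions 0 … k of a word of length k + l + 1 carry a copy of a, positions k … k + l a copy of b.
module Gluing (k l : ℕ) (a b : ℕ → ℕ) where

  Matches : (ℕ → ℕ) → Set
  Matches G = SameOrder (suc k) G a × SameOrder (suc l) (G ∘ (k +_)) b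

  record LowerGluing (lo : ℕ → ℕ) : Set where
    field
      matches : Matches lo
      cross<  : ∀ {i j} → i < k → 0 < j → j < suc l → a i < a k ⊎ b 0 < b j → lo i < lo (k + j)

  record UpperGluing (hi : ℕ → ℕ) : Set where
    field
      matches : Matches hi
      cross>  : ∀ {i j} → i < k → 0 < j → j < suc l → a k < a i ⊎ b j < b 0 → hi (k + j) < hi i

  private
    coefs-through-k : ∀ G → Matches G → ∀ {i j} → i < k → j < suc l →
                 pairCoef (G i) (G k) ≡ pairCoef (a i) (a k) × pairCoef (G k) (G (k + j)) ≡ pairCoef (b 0) (b j)
    coefs-through-k G (pre , suf) i<k j<l =
      coef≡ pre (m<n⇒m<1+n i<k) (n<1+n k) ,
      subst (λ t → pairCoef (G t) (G (k + _)) ≡ _) (+-identityʳ k) (coef≡ suf z<s j<l)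

  cross-coef-⊔ : ∀ G → Matches G → ∀ {i j} → i < k → j < suc l → a k ≤ a i → b j ≤ b 0 →
                 pairCoef (G i) (G (k + j)) ≡ pairCoef (a i) (a k) ⊔ pairCoef (b 0) (b j)
  cross-coef-⊔ G m i<k j<l ak≤ai bj≤b0 =
    trans (pairCoef-⊔ (pairCoef≡⇒≥ (sym e₂) bj≤b0) (pairCoef≡⇒≥ (sym e₁) ak≤ai)) (cong₂ _⊔_ e₁ e₂)
    where e₁ = proj₁ (coefs-through-k G m i<k j<l)
          e₂ = proj₂ (coefs-through-k G m i<k j<l)

  cross-coef-⊓ : ∀ G → Matches G → ∀ {i j} → i < k → j < suc l → a i ≤ a k → b 0 ≤ b j →
                 pairCoef (G i) (G (k + j)) ≡ pairCoef (a i) (a k) ⊓ pairCoef (b 0) (b j)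
  cross-coef-⊓ G m i<k j<l ai≤ak b0≤bj =
    trans (pairCoef-⊓ (pairCoef≡⇒≤ (sym e₁) ai≤ak) (pairCoef≡⇒≤ (sym e₂) b0≤bj)) (cong₂ _⊓_ e₁ e₂)
    where e₁ = proj₁ (coefs-through-k G m i<k j<l)
          e₂ = proj₂ (coefs-through-k G m i<k j<l)

  module _ {lo hi : ℕ → ℕ} (lower : LowerGluing lo) (upper : UpperGluing hi) where
    open LowerGluing lower renaming (matches to lo-matches)
    open UpperGluing upper renaming (matches to hi-matches)

    between⇔Matches : ∀ F → (Coef≤ (k + suc l) lo F × Coef≤ (k + suc l) F hi) ⇔ Matches F
    between⇔Matches F = mk⇔ to from
      where
      k<N : k < k + suc l
      k<N = m<m+n k z<s

      to : Coef≤ (k + suc l) lo F × Coef≤ (k + suc l) F hi → Matches F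
      to (lo≤F , F≤hi) =
        Coef≤-antisym (Coef≤-respʳ (proj₁ hi-matches) (Coef≤-≤ k<N F≤hi))
                      (Coef≤-respˡ (proj₁ lo-matches) (Coef≤-≤ k<N lo≤F)) ,
        Coef≤-antisym (Coef≤-respʳ (proj₂ hi-matches) (Coef≤-shift k F≤hi))
                      (Coef≤-respˡ (proj₂ lo-matches) (Coef≤-shift k lo≤F))

      from : Matches F → Coef≤ (k + suc l) lo F × Coef≤ (k + suc l) F hi
      from mF@(F-pre , F-suf) =
        coefLe (split-pairs k l (within (SameOrder-trans (proj₁ lo-matches) (SameOrder-sym F-pre)))
                                (within (SameOrder-trans (proj₂ lo-matches) (SameOrder-sym F-suf)))
                                lower-cross) ,
        coefLe (split-pairs k l (within (SameOrder-trans F-pre (SameOrder-sym (proj₁ hi-matches))))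
                                (within (SameOrder-trans F-suf (SameOrder-sym (proj₂ hi-matches))))
                                upper-cross)
        where
        within : ∀ {n G H} → SameOrder n G H → ∀ {i j} → i < j → j < n → pairCoef (G i) (G j) ≤ pairCoef (H i) (H j)
        within = coef≤ ∘ SameOrder⇒Coef≤

        lower-cross : ∀ {i j} → i < k → 0 < j → j < suc l → pairCoef (lo i) (lo (k + j)) ≤ pairCoef (F i) (F (k + j))
        lower-cross {i} {j} i<k 0<j j<l with a i <? a k ⊎-dec b 0 <? b j
        ... | yes forced = subst (_≤ _) (sym (pairCoef-< (cross< i<k 0<j j<l forced))) z≤n
        ... | no ¬forced = ≤-reflexive (trans (cross-coef-⊔ lo lo-matches i<k j<l ak≤ai bj≤b0)
                                                (sym (cross-coef-⊔ F mF i<k j<l ak≤ai bj≤b0)))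
          where ak≤ai = ≮⇒≥ (¬forced ∘ inj₁)
                bj≤b0 = ≮⇒≥ (¬forced ∘ inj₂)

        upper-cross : ∀ {i j} → i < k → 0 < j → j < suc l → pairCoef (F i) (F (k + j)) ≤ pairCoef (hi i) (hi (k + j))
        upper-cross {i} {j} i<k 0<j j<l with a k <? a i ⊎-dec b j <? b 0
        ... | yes forced = subst (_ ≤_) (sym (pairCoef-> (cross> i<k 0<j j<l forced))) (pairCoef≤2 _ _)
        ... | no ¬forced = ≤-reflexive (trans (cross-coef-⊓ F mF i<k j<l ai≤ak b0≤bj)
                                                (sym (cross-coef-⊓ hi hi-matches i<k j<l ai≤ak b0≤bj)))
          where ai≤ak = ≮⇒≥ (¬forced ∘ inj₁)
                b0≤bj = ≮⇒≥ (¬forced ∘ inj₂)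

if-bound-≤ : ∀ c {p q r : ℕ} → p ≤ r → q ≤ r → (if c then p else q) ≤ r
if-bound-≤ true  p≤r _   = p≤r
if-bound-≤ false _   q≤r = q≤r

if-bound-≥ : ∀ c {p q r : ℕ} → r ≤ p → r ≤ q → r ≤ (if c then p else q)
if-bound-≥ true  r≤p _   = r≤p
if-bound-≥ false _   r≤q = r≤q

piecewise-strictMono : ∀ (c : ℕ → Bool) {f g : ℕ → ℕ} →
  (∀ {x y} → x ≤ y → c y ≡ true → c x ≡ true) →
  f Preserves _<_ ⟶ _<_ → g Preserves _<_ ⟶ _<_ → (∀ {x y} → x < y → f x < g y) →
  (λ x → if c x then f x else g x) Preserves _<_ ⟶ _<_
piecewise-strictMono c down f-mono g-mono f<g {x} {y} x<y with c x in cx | c y in cy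
... | true  | true  = f-mono x<y
... | false | false = g-mono x<y
... | true  | false = f<g x<y
... | false | true  = contradiction (trans (sym cx) (down (<⇒≤ x<y) cy)) λ ()

<ᵇ-downward : ∀ t {x y} → x ≤ y → (y <ᵇ t) ≡ true → (x <ᵇ t) ≡ true
<ᵇ-downward t {x} {y} x≤y y<t = <ᵇ-true (≤-<-trans x≤y (<ᵇ⇒< y t (Equivalence.from T-≡ y<t)))

≤ᵇ-downward : ∀ t {x y} → x ≤ y → (y ≤ᵇ t) ≡ true → (x ≤ᵇ t) ≡ true
≤ᵇ-downward t {x} {y} x≤y y≤t = ≤ᵇ-true (≤-trans x≤y (≤ᵇ⇒≤ y t (Equivalence.from T-≡ y≤t)))

+∸1-< : ∀ {a b c d} → a < b → c ≤ d → 1 ≤ a + c → a + c ∸ 1 < b + d ∸ 1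
+∸1-< a<b c≤d 1≤a+c = ∸-monoˡ-< (+-mono-<-≤ a<b c≤d) 1≤a+c

+∸1-≤ : ∀ {a b c d} → a ≤ b → c ≤ d → a + c ∸ 1 ≤ b + d ∸ 1
+∸1-≤ a≤b c≤d = ∸-monoˡ-≤ 1 (+-mono-≤ a≤b c≤d)

≤+∸1 : ∀ a {b} → 1 ≤ b → a ≤ a + b ∸ 1
≤+∸1 a 1≤b = subst (_≤ a + _ ∸ 1) (m+n∸n≡m a 1) (+∸1-≤ (≤-refl {a}) 1≤b)

+∸1-strictMono : ∀ {b} → 1 ≤ b → (λ x → x + b ∸ 1) Preserves _<_ ⟶ _<_
+∸1-strictMono {b} 1≤b {x} x<y = +∸1-< x<y ≤-refl (≤-trans 1≤b (m≤n+m b x))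

-- The letter maps of _∧w_ and _∨w_: u ∧w v is definitionally
-- map (meetˡ aₖ b₁) u ++ map (meetʳ aₖ b₁ (maxW u)) (drop 1 v), with aₖ = lastD u and b₁ = headD v,
-- and likewise for u ∨w v.
meetˡ : ℕ → ℕ → ℕ → ℕ
meetˡ aₖ b₁ x = if x <ᵇ aₖ then x else x + b₁ ∸ 1

meetʳ : ℕ → ℕ → ℕ → ℕ → ℕ
meetʳ aₖ b₁ A y = if y ≤ᵇ b₁ then y + aₖ ∸ 1 else y + A ∸ 1

joinˡ : ℕ → ℕ → ℕ → ℕ → ℕ
joinˡ aₖ b₁ B x = if x ≤ᵇ aₖ then x + b₁ ∸ 1 else x + B ∸ 1

joinʳ : ℕ → ℕ → ℕ → ℕ
joinʳ aₖ b₁ y = if y <ᵇ b₁ then y else y + aₖ ∸ 1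

module _ {aₖ b₁ : ℕ} (1≤aₖ : 1 ≤ aₖ) (1≤b₁ : 1 ≤ b₁) where

  meetˡ-strictMono : meetˡ aₖ b₁ Preserves _<_ ⟶ _<_
  meetˡ-strictMono = piecewise-strictMono (_<ᵇ aₖ) (<ᵇ-downward aₖ) id (+∸1-strictMono 1≤b₁)
    (λ {x} {y} x<y → <-≤-trans x<y (≤+∸1 y 1≤b₁))

  meetʳ-strictMono : ∀ {A} → aₖ ≤ A → meetʳ aₖ b₁ A Preserves _<_ ⟶ _<_
  meetʳ-strictMono aₖ≤A = piecewise-strictMono (_≤ᵇ b₁) (≤ᵇ-downward b₁) (+∸1-strictMono 1≤aₖ)
    (+∸1-strictMono (≤-trans 1≤aₖ aₖ≤A)) (λ {x} x<y → +∸1-< x<y aₖ≤A (≤-trans 1≤aₖ (m≤n+m aₖ x)))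

  joinˡ-strictMono : ∀ {B} → b₁ ≤ B → joinˡ aₖ b₁ B Preserves _<_ ⟶ _<_
  joinˡ-strictMono b₁≤B = piecewise-strictMono (_≤ᵇ aₖ) (≤ᵇ-downward aₖ) (+∸1-strictMono 1≤b₁)
    (+∸1-strictMono (≤-trans 1≤b₁ b₁≤B)) (λ {x} x<y → +∸1-< x<y b₁≤B (≤-trans 1≤b₁ (m≤n+m b₁ x)))

  joinʳ-strictMono : joinʳ aₖ b₁ Preserves _<_ ⟶ _<_
  joinʳ-strictMono = piecewise-strictMono (_<ᵇ b₁) (<ᵇ-downward b₁) id (+∸1-strictMono 1≤aₖ)
    (λ {x} {y} x<y → <-≤-trans x<y (≤+∸1 y 1≤aₖ))

  meet-junction : ∀ A → meetˡ aₖ b₁ aₖ ≡ meetʳ aₖ b₁ A b₁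
  meet-junction A = begin
    meetˡ aₖ b₁ aₖ      ≡⟨ cong (if_then aₖ else aₖ + b₁ ∸ 1) (<ᵇ-false (n≮n aₖ)) ⟩
    aₖ + b₁ ∸ 1         ≡⟨ cong (_∸ 1) (+-comm aₖ b₁) ⟩
    b₁ + aₖ ∸ 1         ≡⟨ cong (if_then b₁ + aₖ ∸ 1 else b₁ + A ∸ 1) (≤ᵇ-true (≤-refl {b₁})) ⟨
    meetʳ aₖ b₁ A b₁    ∎
    where open ≡-Reasoning

  join-junction : ∀ B → joinˡ aₖ b₁ B aₖ ≡ joinʳ aₖ b₁ b₁
  join-junction B = begin
    joinˡ aₖ b₁ B aₖ    ≡⟨ cong (if_then aₖ + b₁ ∸ 1 else aₖ + B ∸ 1) (≤ᵇ-true (≤-refl {aₖ})) ⟩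
    aₖ + b₁ ∸ 1         ≡⟨ cong (_∸ 1) (+-comm aₖ b₁) ⟩
    b₁ + aₖ ∸ 1         ≡⟨ cong (if_then b₁ else b₁ + aₖ ∸ 1) (<ᵇ-false (n≮n b₁)) ⟨
    joinʳ aₖ b₁ b₁      ∎
    where open ≡-Reasoning

  meet-cross : ∀ {A x y} → aₖ ≤ A → x ≤ A → 1 ≤ y → x < aₖ ⊎ b₁ < y → meetˡ aₖ b₁ x < meetʳ aₖ b₁ A y
  meet-cross {A} {x} {y} aₖ≤A x≤A 1≤y (inj₁ x<aₖ) = begin-strict
    meetˡ aₖ b₁ x    ≡⟨ cong (if_then x else x + b₁ ∸ 1) (<ᵇ-true x<aₖ) ⟩
    x                <⟨ x<aₖ ⟩
    aₖ               ≤⟨ ≤+∸1 aₖ 1≤y ⟩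
    aₖ + y ∸ 1       ≡⟨ cong (_∸ 1) (+-comm aₖ y) ⟩
    y + aₖ ∸ 1       ≤⟨ if-bound-≥ (y ≤ᵇ b₁) ≤-refl (+∸1-≤ (≤-refl {y}) aₖ≤A) ⟩
    meetʳ aₖ b₁ A y  ∎
    where open ≤-Reasoning
  meet-cross {A} {x} {y} aₖ≤A x≤A 1≤y (inj₂ b₁<y) = begin-strict
    meetˡ aₖ b₁ x    ≤⟨ if-bound-≤ (x <ᵇ aₖ) (≤+∸1 x 1≤b₁) ≤-refl ⟩
    x + b₁ ∸ 1       ≡⟨ cong (_∸ 1) (+-comm x b₁) ⟩
    b₁ + x ∸ 1       <⟨ +∸1-< b₁<y x≤A (≤-trans 1≤b₁ (m≤m+n b₁ x)) ⟩
    y + A ∸ 1        ≡⟨ cong (if_then y + aₖ ∸ 1 else y + A ∸ 1) (≤ᵇ-false (<⇒≱ b₁<y)) ⟨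
    meetʳ aₖ b₁ A y  ∎
    where open ≤-Reasoning

  join-cross : ∀ {B x y} → b₁ ≤ B → 1 ≤ x → y ≤ B → aₖ < x ⊎ y < b₁ → joinʳ aₖ b₁ y < joinˡ aₖ b₁ B x
  join-cross {B} {x} {y} b₁≤B 1≤x y≤B (inj₁ aₖ<x) = begin-strict
    joinʳ aₖ b₁ y    ≤⟨ if-bound-≤ (y <ᵇ b₁) (≤+∸1 y 1≤aₖ) ≤-refl ⟩
    y + aₖ ∸ 1       ≡⟨ cong (_∸ 1) (+-comm y aₖ) ⟩
    aₖ + y ∸ 1       <⟨ +∸1-< aₖ<x y≤B (≤-trans 1≤aₖ (m≤m+n aₖ y)) ⟩
    x + B ∸ 1        ≡⟨ cong (if_then x + b₁ ∸ 1 else x + B ∸ 1) (≤ᵇ-false (<⇒≱ aₖ<x)) ⟨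
    joinˡ aₖ b₁ B x  ∎
    where open ≤-Reasoning
  join-cross {B} {x} {y} b₁≤B 1≤x y≤B (inj₂ y<b₁) = begin-strict
    joinʳ aₖ b₁ y    ≡⟨ cong (if_then y else y + aₖ ∸ 1) (<ᵇ-true y<b₁) ⟩
    y                <⟨ y<b₁ ⟩
    b₁               ≤⟨ ≤+∸1 b₁ 1≤x ⟩
    b₁ + x ∸ 1       ≡⟨ cong (_∸ 1) (+-comm b₁ x) ⟩
    x + b₁ ∸ 1       ≤⟨ if-bound-≥ (x ≤ᵇ aₖ) ≤-refl (+∸1-≤ (≤-refl {x}) b₁≤B) ⟩
    joinˡ aₖ b₁ B x  ∎
    where open ≤-Reasoning

module _ (f g : ℕ → ℕ) (a₀ : ℕ) (as : Word) (b₀ : ℕ) (bs : Word) where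
  private
    W = map f (a₀ ∷ as) ++ map g bs

  at-glued-left : ∀ {p} → p < suc (length as) → at W p ≡ f (at (a₀ ∷ as) p)
  at-glued-left {p} p<k = trans (at-++ˡ (map f (a₀ ∷ as)) (map g bs) (subst (p <_) (sym (length-map f (a₀ ∷ as))) p<k))
                            (at-map f (a₀ ∷ as) p<k)

  at-glued-right : f (lastD (a₀ ∷ as)) ≡ g b₀ →
                   ∀ {j} → j < suc (length bs) → at W (length as + j) ≡ g (at (b₀ ∷ bs) j)
  at-glued-right junction {zero} _ = begin
    at W (length as + 0)         ≡⟨ cong (at W) (+-identityʳ (length as)) ⟩
    at W (length as)             ≡⟨ at-glued-left (n<1+n (length as)) ⟩
    f (at (a₀ ∷ as) (length as)) ≡⟨ cong f (lastD≡at a₀ as) ⟨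
    f (lastD (a₀ ∷ as))          ≡⟨ junction ⟩
    g b₀                         ∎
    where open ≡-Reasoning
  at-glued-right _ {suc j} (s≤s j<l) = begin
    at W (length as + suc j)             ≡⟨ cong (at W) (trans (+-suc (length as) j)
                                                    (cong (_+ j) (sym (length-map f (a₀ ∷ as))))) ⟩
    at W (length (map f (a₀ ∷ as)) + j)  ≡⟨ at-++ʳ (map f (a₀ ∷ as)) (map g bs) j ⟩
    at (map g bs) j                      ≡⟨ at-map g bs j<l ⟩
    g (at bs j)                          ∎
    where open ≡-Reasoning

  length-glued : length W ≡ length as + suc (length bs)
  length-glued = begin
    length W                                      ≡⟨ length-++ (map f (a₀ ∷ as)) ⟩
    length (map f (a₀ ∷ as)) + length (map g bs)  ≡⟨ cong₂ _+_ (length-map f (a₀ ∷ as)) (length-map g bs) ⟩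
    suc (length as + length bs)                   ≡⟨ +-suc (length as) (length bs) ⟨
    length as + suc (length bs)                   ∎
    where open ≡-Reasoning

  glued-Matches : f (lastD (a₀ ∷ as)) ≡ g b₀ → f Preserves _<_ ⟶ _<_ → g Preserves _<_ ⟶ _<_ →
                  Gluing.Matches (length as) (length bs) (at (a₀ ∷ as)) (at (b₀ ∷ bs)) (at W)
  glued-Matches junction f-mono g-mono =
    SameOrder-congˡ (sym ∘ at-glued-left) (strictMono⇒SameOrder f-mono (at (a₀ ∷ as))) ,
    SameOrder-congˡ (sym ∘ at-glued-right junction) (strictMono⇒SameOrder g-mono (at (b₀ ∷ bs)))

All-at⁺ : ∀ {P : ℕ → Set} w → (∀ {i} → i < length w → P (at w i)) → All P w
All-at⁺ []      _ = []
All-at⁺ (x ∷ w) p = p z<s ∷ All-at⁺ w (p ∘ s≤s)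

wordsOver-suc : ∀ m n → wordsOver m (suc n) ≡ cartesianProductWith _∷_ (applyUpTo suc m) (wordsOver m n)
wordsOver-suc m n = go (applyUpTo suc m)
  where
  go : ∀ xs → concatMap (λ a → map (a ∷_) (wordsOver m n)) xs ≡ cartesianProductWith _∷_ xs (wordsOver m n)
  go []       = refl
  go (x ∷ xs) = cong (map (x ∷_) (wordsOver m n) ++_) (go xs)

∈-wordsOver⁺ : ∀ m n w → length w ≡ n → All (λ a → 1 ≤ a × a ≤ m) w → w ∈ wordsOver m n
∈-wordsOver⁺ m zero    []      refl []                          = here refl
∈-wordsOver⁺ m (suc n) (suc c ∷ w) len ((_ , c<m) ∷ bounds) rewrite wordsOver-suc m n =
  ∈-cartesianProductWith⁺ _∷_ (∈-applyUpTo⁺ suc c<m) (∈-wordsOver⁺ m n w (suc-injective len) bounds)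

wordsOver-length : ∀ m n {w} → w ∈ wordsOver m n → length w ≡ n
wordsOver-length m zero    (here refl) = refl
wordsOver-length m (suc n) w∈ rewrite wordsOver-suc m n
  with _ , _ , _ , w′∈ , refl ← ∈-cartesianProductWith⁻ _∷_ (applyUpTo suc m) (wordsOver m n) w∈
  = cong suc (wordsOver-length m n w′∈)

wordsOver-Unique : ∀ m n → Unique (wordsOver m n)
wordsOver-Unique m zero    = [] ∷ []
wordsOver-Unique m (suc n) rewrite wordsOver-suc m n =
  Unique.cartesianProductWith⁺ _∷_ ∷-injective
    (Unique.applyUpTo⁺₁ suc m λ i<j _ → <⇒≢ i<j ∘ suc-injective) (wordsOver-Unique m n)

pack∈packedWords⇔ : ∀ n w → pack w ∈ packedWords n ⇔ length w ≡ n
pack∈packedWords⇔ n w = mk⇔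
  (λ ∈pw → trans (sym (length-pack w)) (wordsOver-length n n (proj₁ (∈-filter⁻ _ ∈pw))))
  (λ { refl → ∈-filter⁺ _ (∈-wordsOver⁺ (length w) (length w) (pack w) (length-pack w)
                             (All-at⁺ (pack w) (pack-letter-bounds w ∘ subst (_ <_) (length-pack w))))
                          (pack-idem w) })

interval-Unique : ∀ n lo hi → Unique (interval n lo hi)
interval-Unique n lo hi = Unique.filter⁺ _ (Unique.filter⁺ _ (wordsOver-Unique n n))

packed⇒1≤at : ∀ {u} → IsPacked u → ∀ {i} → i < length u → 1 ≤ at u i
packed⇒1≤at {u} packed {i} i<n = subst (λ w → 1 ≤ at w i) packed (proj₁ (pack-letter-bounds u i<n))

module _ {a₀ b₀ : ℕ} {as bs : Word} (u-packed : IsPacked (a₀ ∷ as)) (v-packed : IsPacked (b₀ ∷ bs)) where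
  private
    u = a₀ ∷ as
    v = b₀ ∷ bs
    k = length as
    l = length bs
    N = k + suc l
    aₖ = lastD u
    aₖ≡at : at u k ≡ aₖ
    aₖ≡at = sym (lastD≡at a₀ as)
    1≤aₖ : 1 ≤ aₖ
    1≤aₖ = subst (1 ≤_) aₖ≡at (packed⇒1≤at u-packed (n<1+n k))
    1≤b₀ : 1 ≤ b₀
    1≤b₀ = packed⇒1≤at v-packed z<s
    aₖ≤maxW : aₖ ≤ maxW u
    aₖ≤maxW = subst (_≤ maxW u) aₖ≡at (at≤maxW u k)

  open Gluing k l (at u) (at v)

  ∧w-LowerGluing : LowerGluing (at (u ∧w v))
  ∧w-LowerGluing = record
    { matches = glued-Matches _ _ a₀ as b₀ bs junction
                  (meetˡ-strictMono 1≤aₖ 1≤b₀) (meetʳ-strictMono 1≤aₖ 1≤b₀ aₖ≤maxW)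
    ; cross<  = λ {i} i<k _ j<l forced → subst₂ _<_
        (sym (at-glued-left _ _ a₀ as b₀ bs (m<n⇒m<1+n i<k)))
        (sym (at-glued-right _ _ a₀ as b₀ bs junction j<l))
        (meet-cross 1≤aₖ 1≤b₀ aₖ≤maxW (at≤maxW u i) (packed⇒1≤at v-packed j<l)
                    (map₁ (subst (at u i <_) aₖ≡at) forced))
    }
    where junction = meet-junction 1≤aₖ 1≤b₀ (maxW u)

  ∨w-UpperGluing : UpperGluing (at (u ∨w v))
  ∨w-UpperGluing = record
    { matches = glued-Matches _ _ a₀ as b₀ bs junction
                  (joinˡ-strictMono 1≤aₖ 1≤b₀ (at≤maxW v 0)) (joinʳ-strictMono 1≤aₖ 1≤b₀)
    ; cross>  = λ {i} {j} i<k _ j<l forced → subst₂ _<_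
        (sym (at-glued-right _ _ a₀ as b₀ bs junction j<l))
        (sym (at-glued-left _ _ a₀ as b₀ bs (m<n⇒m<1+n i<k)))
        (join-cross 1≤aₖ 1≤b₀ (at≤maxW v 0) (packed⇒1≤at u-packed (m<n⇒m<1+n i<k)) (at≤maxW v j)
                    (map₁ (subst (_< at u i) aₖ≡at) forced))
    }
    where junction = join-junction 1≤aₖ 1≤b₀ (maxW v)

  pack-take-drop⇒length : ∀ w → pack (take (suc k) w) ≡ u → pack (drop k w) ≡ v → length w ≡ N
  pack-take-drop⇒length w pt pd = begin
    length w            ≡⟨ m+[n∸m]≡n (<⇒≤ k<n) ⟨
    k + (length w ∸ k)  ≡⟨ cong (k +_) (trans (sym (length-drop k w)) (pack≡⇒length≡ pd)) ⟩
    N                   ∎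
    where
    open ≡-Reasoning
    k<n : k < length w
    k<n = m⊓n≡m⇒m≤n (trans (sym (length-take (suc k) w)) (pack≡⇒length≡ pt))

  Matches⇔pack-take-drop : ∀ w → length w ≡ N → Matches (at w) ⇔ (pack (take (suc k) w) ≡ u × pack (drop k w) ≡ v)
  Matches⇔pack-take-drop w len = mk⇔
    (λ (pre , suf) →
      Equivalence.from (pack≡⇔SameOrder _ u u-packed) (take-length , SameOrder-congˡ (sym ∘ at-take _ w) pre) ,
      Equivalence.from (pack≡⇔SameOrder _ v v-packed) (drop-length , SameOrder-congˡ (sym ∘ drop≗) suf))
    (λ (pt , pd) → SameOrder-congˡ (at-take _ w) (proj₂ (Equivalence.to (pack≡⇔SameOrder _ u u-packed) pt))
                 , SameOrder-congˡ drop≗ (proj₂ (Equivalence.to (pack≡⇔SameOrder _ v v-packed) pd)))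
    where
    take-length : length (take (suc k) w) ≡ suc k
    take-length = trans (length-take (suc k) w) (m≤n⇒m⊓n≡m (subst (k <_) (sym len) (m<m+n k z<s)))
    drop-length : length (drop k w) ≡ suc l
    drop-length = trans (length-drop k w) (trans (cong (_∸ k) len) (m+n∸m≡n k (suc l)))
    drop≗ : ∀ {i} → i < suc l → at (drop k w) i ≡ at w (k + i)
    drop≗ {i} _ = at-drop k w i

  pack∈interval⇔ : ∀ w → pack w ∈ interval N (u ∧w v) (u ∨w v) ⇔ (pack (take (suc k) w) ≡ u × pack (drop k w) ≡ v)
  pack∈interval⇔ w = mk⇔ to from
    where
    length-∧w : length (u ∧w v) ≡ N
    length-∧w = length-glued _ _ a₀ as b₀ bs
    length-∨w : length (u ∨w v) ≡ N
    length-∨w = length-glued _ _ a₀ as b₀ bs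

    module _ (len : length w ≡ N) where
      bounds⇔Matches : ((u ∧w v) ≤pp pack w × pack w ≤pp (u ∨w v)) ⇔ Matches (at w)
      bounds⇔Matches = ⇔.trans
        (≤pp-pack⇔ (u ∧w v) w length-∧w len ×-⇔ pack-≤pp⇔ (u ∨w v) w length-∨w len)
        (between⇔Matches ∧w-LowerGluing ∨w-UpperGluing (at w))

    to : pack w ∈ interval N (u ∧w v) (u ∨w v) → pack (take (suc k) w) ≡ u × pack (drop k w) ≡ v
    to ∈I with ∈packed , bounds ← ∈-filter⁻ (λ x → ((u ∧w v) ≤pp? x) ×-dec (x ≤pp? (u ∨w v))) ∈I =
      let len = Equivalence.to (pack∈packedWords⇔ N w) ∈packed in
      Equivalence.to (Matches⇔pack-take-drop w len) (Equivalence.to (bounds⇔Matches len) bounds)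

    from : pack (take (suc k) w) ≡ u × pack (drop k w) ≡ v → pack w ∈ interval N (u ∧w v) (u ∨w v)
    from (pt , pd) = ∈-filter⁺ _ (Equivalence.from (pack∈packedWords⇔ N w) len)
      (Equivalence.from (bounds⇔Matches len) (Equivalence.from (Matches⇔pack-take-drop w len) (pt , pd)))
      where len = pack-take-drop⇒length w pt pd

module _ {c ℓ} (R : CommutativeRing c ℓ) where
  open CommutativeRing R
    using (Carrier; _≈_; 0#; 1#; setoid; zeroˡ; zeroʳ)
    renaming ( _*_ to _*ᴿ_; refl to ≈-refl; sym to ≈-sym; trans to ≈-trans
             ; +-identityˡ to +ᴿ-identityˡ; +-identityʳ to +ᴿ-identityʳ; *-identityˡ to *ᴿ-identityˡ
             ; +-cong to +ᴿ-cong; *-cong to *ᴿ-cong)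
  open Series R
  open import Relation.Binary.Reasoning.Setoid setoid

  𝟙 : ∀ {P : Set} → Dec P → Carrier
  𝟙 d = if ⌊ d ⌋ then 1# else 0#

  𝟙-yes : ∀ {P : Set} → P → (d : Dec P) → 𝟙 d ≈ 1#
  𝟙-yes p (yes _) = ≈-refl
  𝟙-yes p (no ¬p) = contradiction p ¬p

  𝟙-no : ∀ {P : Set} → ¬ P → (d : Dec P) → 𝟙 d ≈ 0#
  𝟙-no ¬p (yes p) = contradiction p ¬p
  𝟙-no ¬p (no _)  = ≈-refl

  𝟙-cong : ∀ {P Q : Set} → P ⇔ Q → (p : Dec P) (q : Dec Q) → 𝟙 p ≈ 𝟙 q
  𝟙-cong P⇔Q (yes p) q = ≈-sym (𝟙-yes (Equivalence.to P⇔Q p) q)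
  𝟙-cong P⇔Q (no ¬p) q = ≈-sym (𝟙-no (¬p ∘ Equivalence.from P⇔Q) q)

  𝟙-× : ∀ {P Q : Set} (p : Dec P) (q : Dec Q) → 𝟙 (p ×-dec q) ≈ 𝟙 p *ᴿ 𝟙 q
  𝟙-× (yes _) (yes _) = ≈-sym (*ᴿ-identityˡ 1#)
  𝟙-× (yes _) (no _)  = ≈-sym (zeroʳ 1#)
  𝟙-× (no _)  q       = ≈-sym (zeroˡ (𝟙 q))

  Σ-applyUpTo-zero : ∀ g n → (∀ {i} → i < n → g i ≈ 0#) → Σ (applyUpTo g n) ≈ 0#
  Σ-applyUpTo-zero g zero    _    = ≈-refl
  Σ-applyUpTo-zero g (suc n) g≈0 =
    ≈-trans (+ᴿ-cong (g≈0 z<s) (Σ-applyUpTo-zero (g ∘ suc) n (g≈0 ∘ s≤s))) (+ᴿ-identityʳ 0#)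

  Σ-applyUpTo-single : ∀ g n {m} → m < n → (∀ {i} → i < n → i ≢ m → g i ≈ 0#) → Σ (applyUpTo g n) ≈ g m
  Σ-applyUpTo-single g (suc n) {zero}  _         g≈0 =
    ≈-trans (+ᴿ-cong ≈-refl (Σ-applyUpTo-zero (g ∘ suc) n λ i<n → g≈0 (s≤s i<n) λ ())) (+ᴿ-identityʳ (g 0))
  Σ-applyUpTo-single g (suc n) {suc m} (s≤s m<n) g≈0 =
    ≈-trans (+ᴿ-cong (g≈0 z<s λ ())
                     (Σ-applyUpTo-single (g ∘ suc) n m<n λ i<n i≢m → g≈0 (s≤s i<n) (i≢m ∘ suc-injective)))
            (+ᴿ-identityˡ (g (suc m)))

  ΣM-∉ : ∀ xs {w} → pack w ∉ xs → ΣM xs w ≈ 0#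
  ΣM-∉ []       _   = ≈-refl
  ΣM-∉ (x ∷ xs) w∉ =
    ≈-trans (+ᴿ-cong (𝟙-no (w∉ ∘ here) (≡-dec _≟_ _ x)) (ΣM-∉ xs (w∉ ∘ there))) (+ᴿ-identityʳ 0#)

  ΣM-∈ : ∀ xs {w} → Unique xs → pack w ∈ xs → ΣM xs w ≈ 1#
  ΣM-∈ (x ∷ xs) (x∉xs ∷ _) (here refl) =
    ≈-trans (+ᴿ-cong (𝟙-yes refl (≡-dec _≟_ x x)) (ΣM-∉ xs (λ x∈ → lookup x∉xs x∈ refl))) (+ᴿ-identityʳ 1#)
  ΣM-∈ (x ∷ xs) (x∉xs ∷ unique) (there w∈) =
    ≈-trans (+ᴿ-cong (𝟙-no (λ { refl → lookup x∉xs w∈ refl }) (≡-dec _≟_ _ x)) (ΣM-∈ xs unique w∈))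
            (+ᴿ-identityˡ 1#)

  ΣM≈𝟙∈ : ∀ xs w → Unique xs → (d : Dec (pack w ∈ xs)) → ΣM xs w ≈ 𝟙 d
  ΣM≈𝟙∈ xs w unique (yes ∈xs) = ΣM-∈ xs unique ∈xs
  ΣM≈𝟙∈ xs w unique (no ∉xs)  = ΣM-∉ xs ∉xs

  M≈0-length : ∀ u x → length x ≢ length u → M u x ≈ 0#
  M≈0-length u x len≢ = 𝟙-no (len≢ ∘ pack≡⇒length≡) (≡-dec _≟_ (pack x) u)

  M#M≈M*M : ∀ a₀ as v w → (M (a₀ ∷ as) # M v) w ≈ M (a₀ ∷ as) (take (suc (length as)) w) *ᴿ M v (drop (length as) w)
  M#M≈M*M a₀ as v w = by-cases (length as <? length w)
    where
    term : ℕ → Carrier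
    term i = M (a₀ ∷ as) (take (suc i) w) *ᴿ M v (drop i w)

    term≈0 : ∀ {i} → length (take (suc i) w) ≢ suc (length as) → term i ≈ 0#
    term≈0 {i} len≢ = ≈-trans (*ᴿ-cong (M≈0-length (a₀ ∷ as) (take (suc i) w) len≢) ≈-refl) (zeroˡ _)

    prefix≢ : ∀ {i} → i < length w → i ≢ length as → length (take (suc i) w) ≢ suc (length as)
    prefix≢ {i} i<n i≢k e = i≢k (suc-injective (trans (sym (m≤n⇒m⊓n≡m i<n)) (trans (sym (length-take (suc i) w)) e)))

    by-cases : Dec (length as < length w) → (M (a₀ ∷ as) # M v) w ≈ term (length as)
    by-cases (yes k<n) = begin
      (M (a₀ ∷ as) # M v) w          ≡⟨ cong Σ (map-upTo term (length w)) ⟩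
      Σ (applyUpTo term (length w))  ≈⟨ Σ-applyUpTo-single term (length w) k<n (λ i<n i≢k → term≈0 (prefix≢ i<n i≢k)) ⟩
      term (length as)               ∎
    by-cases (no k≮n) = begin
      (M (a₀ ∷ as) # M v) w          ≡⟨ cong Σ (map-upTo term (length w)) ⟩
      Σ (applyUpTo term (length w))  ≈⟨ Σ-applyUpTo-zero term (length w) (λ i<n → term≈0 (prefix≢ i<n λ { refl → k≮n i<n })) ⟩
      0#                             ≈⟨ term≈0 (k≮n ∘ m⊓n≡m⇒m≤n ∘ trans (sym (length-take (suc (length as)) w))) ⟨
      term (length as)               ∎

  M#M≈ΣM-interval : ∀ {a₀ b₀ as bs} → IsPacked (a₀ ∷ as) → IsPacked (b₀ ∷ bs) → ∀ w →
    let u = a₀ ∷ as; v = b₀ ∷ bs in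
    (M u # M v) w ≈ ΣM (interval (length as + suc (length bs)) (u ∧w v) (u ∨w v)) w
  M#M≈ΣM-interval {a₀} {b₀} {as} {bs} u-packed v-packed w = begin
    (M u # M v) w                                     ≈⟨ M#M≈M*M a₀ as v w ⟩
    M u (take (suc (length as)) w) *ᴿ M v (drop (length as) w)
                                                      ≈⟨ 𝟙-× (≡-dec _≟_ _ u) (≡-dec _≟_ _ v) ⟨
    𝟙 (≡-dec _≟_ _ u ×-dec ≡-dec _≟_ _ v)             ≈⟨ 𝟙-cong (⇔.sym (pack∈interval⇔ u-packed v-packed w)) _ (pack w ∈? I) ⟩
    𝟙 (pack w ∈? I)                                   ≈⟨ ΣM≈𝟙∈ I w (interval-Unique N _ _) (pack w ∈? I) ⟨
    ΣM I w                                            ∎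
    where
    u = a₀ ∷ as
    v = b₀ ∷ bs
    N = length as + suc (length bs)
    I = interval N (u ∧w v) (u ∨w v)

theorem5p2 : ∀ {c ℓ : Level} (R : CommutativeRing c ℓ) (u v : Word) →
    IsPacked u → IsPacked v → u ≢ [] → v ≢ [] →
    (a : ℕ) (w : Word) → All (1 ≤_) (a ∷ w) →
    CommutativeRing._≈_ R
    (Series._#_ R (Series.M R u) (Series.M R v) (a ∷ w))
    (Series.ΣM R (interval (length u + length v ∸ 1) (u ∧w v) (u ∨w v)) (a ∷ w))
theorem5p2 R []        _         _        _        u≢[] _    _ _ _ = contradiction refl u≢[]
theorem5p2 R (_ ∷ _)   []        _        _        _    v≢[] _ _ _ = contradiction refl v≢[]
theorem5p2 R (_ ∷ _)   (_ ∷ _)   u-packed v-packed _    _    a w _ = M#M≈ΣM-interval R u-packed v-packed (a ∷ w)
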